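{- For integers $n \geq 1$ define \[ \mathbf{F}_n(x) = \sum_{\nu=1}^n \nu!\,\mathbf{S}_2(n,\nu)\, x^\nu, \qquad \widehat{\mathbf{F}}_n(x) = \sum_{\nu=1}^n \nu!\,\mathbf{S}_2(n,\nu)\, \mathbf{H}_\nu\, x^\nu. \] Then for all $n \geq 1$, \[ \widehat{\mathbf{F}}_n(x) = \sum_{\nu=1}^n (-1)^{\nu+1}\,\frac{\mathbf{F}_n^{(\nu)}(x)}{\nu!}\,\frac{x^\nu}{\nu}, \] where $\mathbf{F}_n^{(\nu)}$ denotes the $\nu$-th derivative of $\mathbf{F}_n$.
   Context: $\mathbf{S}_2(n,k)$ denotes the Stirling numbers of the second kind. $\mathbf{H}_\nu = \sum_{j=1}^\nu 1/j$ is the $\nu$-th harmonic number. -}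

module Defs where

open import Data.Nat as ℕ using (ℕ; zero; suc; _!)
open import Data.Integer using (+_)
open import Data.List using (List; []; _∷_; replicate; _++_)
open import Data.Rational using (ℚ; 0ℚ; 1ℚ; _/_; -_) renaming (_+_ to _+ℚ_; _*_ to _*ℚ_)
open import Function using (_∘_)

S₂ : ℕ → ℕ → ℕ
S₂ zero    zero    = 1
S₂ zero    (suc k) = 0
S₂ (suc n) zero    = 0
S₂ (suc n) (suc k) = suc k ℕ.* S₂ n (suc k) ℕ.+ S₂ n k

ι : ℕ → ℚ
ι n = + n / 1

-- reciprocal 1/m of a positive natural (value at 0 is irrelevant, set to 0)
recip : ℕ → ℚ
recip zero    = 0ℚ
recip (suc m) = + 1 / suc m

H : ℕ → ℚ
H zero    = 0ℚ
H (suc ν) = H ν +ℚ recip (suc ν)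

pow : ℚ → ℕ → ℚ
pow x zero    = 1ℚ
pow x (suc k) = x *ℚ pow x k

Σ₁ : ℕ → (ℕ → ℚ) → ℚ
Σ₁ zero    f = 0ℚ
Σ₁ (suc n) f = Σ₁ n f +ℚ f (suc n)

-- Polynomials over ℚ as coefficient lists, lowest degree first
Poly : Set
Poly = List ℚ

_⊕_ : Poly → Poly → Poly
[]       ⊕ q        = q
(a ∷ p)  ⊕ []       = a ∷ p
(a ∷ p)  ⊕ (b ∷ q)  = (a +ℚ b) ∷ (p ⊕ q)

monomial : ℚ → ℕ → Poly
monomial c ν = replicate ν 0ℚ ++ (c ∷ [])

ΣP₁ : ℕ → (ℕ → Poly) → Poly
ΣP₁ zero    f = []
ΣP₁ (suc n) f = ΣP₁ n f ⊕ f (suc n)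

eval : Poly → ℚ → ℚ
eval []      x = 0ℚ
eval (a ∷ p) x = a +ℚ x *ℚ eval p x

derivAux : ℕ → Poly → Poly
derivAux k []      = []
derivAux k (a ∷ p) = (ι k *ℚ a) ∷ derivAux (suc k) p

deriv : Poly → Poly
deriv []      = []
deriv (a ∷ p) = derivAux 1 p

deriv^ : ℕ → Poly → Poly
deriv^ zero    p = p
deriv^ (suc k) p = deriv (deriv^ k p)

F : ℕ → Poly
F n = ΣP₁ n (λ ν → monomial (ι (ν ! ℕ.* S₂ n ν)) ν)

Fhat : ℕ → Poly
Fhat n = ΣP₁ n (λ ν → monomial (ι (ν ! ℕ.* S₂ n ν) *ℚ H ν) ν)

sign : ℕ → ℚ
sign zero    = 1ℚ
sign (suc k) = - sign k

-- The identity  F̂ₙ(x) = Σ_{ν=1}^{n} (-1)^{ν+1} Fₙ^{(ν)}(x)/ν! · x^ν/ν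
-- is an interchange of two finite sums once two classical facts are known.
--
--  (1) Harmonic numbers as alternating binomial sums: for k ≤ N,
--        H_k = Σ_{ν=1}^{N} (-1)^{ν+1} C(k,ν)/ν.
--      Proved by induction on k from Pascal's rule, the absorption identity
--      (ν+1)·C(k+1,ν+1) = (k+1)·C(k,ν) and the vanishing of the alternating
--      row sums of Pascal's triangle.
--  (2) Taylor coefficients: for P = Σ_{k=1}^{n} c_k X^k,
--        P^{(ν)}(x)/ν! · x^ν = Σ_{k=1}^{n} c_k C(k,ν) x^k,
--      which reduces, by additivity of evaluation and differentiation, to
--      the monomial case (X^k)^{(ν)} = ν!·C(k,ν)·X^{k-ν}.
--
-- With a_k = k!·S₂(n,k), fact (1) rewrites F̂ₙ(x) = Σ_k a_k H_k x^k as the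
-- double sum Σ_k Σ_ν a_k x^k (-1)^{ν+1} C(k,ν)/ν; after swapping the sums,
-- fact (2) for P = Fₙ identifies the inner sums with the right-hand side.

module Submission where

open import Defs
open import Data.Nat using (ℕ; _≤_; suc; _!)
open import Data.Rational using (ℚ; _*_)
open import Relation.Binary.PropositionalEquality using (_≡_)

open import Data.Nat as ℕ using (zero; _<_; s≤s; NonZero)
import Data.Nat.Properties as ℕP
open import Data.Nat.Combinatorics using (_C_; nCk+nC[k+1]≡[n+1]C[k+1]; k>n⇒nCk≡0; nC1≡n)
import Data.Nat.Tactic.RingSolver as ℕSolver
open import Data.Nat.Coprimality using (1-coprimeTo) renaming (sym to coprime-sym)
import Data.Integer as ℤ
import Data.Integer.Properties as ℤP
open import Data.Rational as ℚ using (mkℚ; 0ℚ; 1ℚ; _+_; -_)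
import Data.Rational.Properties as ℚP
open import Data.List using ([]; _∷_; replicate; _++_)
open import Relation.Nullary.Decidable using (dec⇒maybe)
open import Relation.Binary.PropositionalEquality
  using (refl; sym; trans; cong; cong₂; module ≡-Reasoning)
open import Tactic.RingSolver using (solve-∀)
open import Tactic.RingSolver.Core.AlmostCommutativeRing
  using (AlmostCommutativeRing; fromCommutativeRing)

open ≡-Reasoning

ℚ-ring : AlmostCommutativeRing _ _
ℚ-ring = fromCommutativeRing ℚP.+-*-commutativeRing (λ x → dec⇒maybe (0ℚ ℚP.≟ x))

ι-normal : ∀ n → ι n ≡ mkℚ (ℤ.+ n) 0 (coprime-sym (1-coprimeTo n))
ι-normal n = ℚP.normalize-coprime (coprime-sym (1-coprimeTo n))

ι-+ : ∀ m n → ι (m ℕ.+ n) ≡ ι m + ι n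
ι-+ m n = begin
  ι (m ℕ.+ n)                                  ≡⟨ cong (ℚ._/ 1) numerator ⟩
  (ℤ.+ m ℤ.* ℤ.+ 1 ℤ.+ ℤ.+ n ℤ.* ℤ.+ 1) ℚ./ 1  ≡⟨ cong₂ _+_ (ι-normal m) (ι-normal n) ⟨
  ι m + ι n                                    ∎
  where
  numerator : ℤ.+ (m ℕ.+ n) ≡ ℤ.+ m ℤ.* ℤ.+ 1 ℤ.+ ℤ.+ n ℤ.* ℤ.+ 1
  numerator = trans (ℤP.pos-+ m n)
    (sym (cong₂ ℤ._+_ (ℤP.*-identityʳ (ℤ.+ m)) (ℤP.*-identityʳ (ℤ.+ n))))

ι-* : ∀ m n → ι (m ℕ.* n) ≡ ι m * ι n
ι-* m n = begin
  ι (m ℕ.* n)                ≡⟨ cong (ℚ._/ 1) (ℤP.pos-* m n) ⟩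
  (ℤ.+ m ℤ.* ℤ.+ n) ℚ./ 1    ≡⟨ cong₂ _*_ (ι-normal m) (ι-normal n) ⟨
  ι m * ι n                  ∎

ι-recip : ∀ m → {{NonZero m}} → ι m * recip m ≡ 1ℚ
ι-recip (suc m) = begin
  ι (suc m) * recip (suc m)  ≡⟨ cong₂ _*_ (ι-normal (suc m)) (ℚP.normalize-coprime (1-coprimeTo (suc m))) ⟩
  q * ℚ.1/ q                 ≡⟨ ℚP.*-inverseʳ q ⟩
  1ℚ                         ∎
  where
  q : ℚ
  q = mkℚ (ℤ.+ suc m) 0 (coprime-sym (1-coprimeTo (suc m)))

cross-ratio : ∀ a b X Y → {{NonZero a}} → {{NonZero b}} →
  b ℕ.* Y ≡ a ℕ.* X → ι X * recip b ≡ recip a * ι Y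
cross-ratio a b X Y bY≡aX = begin
  ι X * recip b                      ≡⟨ unit-left (ι X * recip b) ⟩
  1ℚ * (ι X * recip b)               ≡⟨ cong (_* (ι X * recip b)) (ι-recip a) ⟨
  (ι a * recip a) * (ι X * recip b)  ≡⟨ regroup (ι a) (recip a) (ι X) (recip b) ⟩
  recip a * (ι a * ι X) * recip b    ≡⟨ cong (λ z → recip a * z * recip b) product ⟩
  recip a * (ι b * ι Y) * recip b    ≡⟨ regroup′ (recip a) (ι b) (ι Y) (recip b) ⟩
  recip a * ι Y * (ι b * recip b)    ≡⟨ cong (recip a * ι Y *_) (ι-recip b) ⟩
  recip a * ι Y * 1ℚ                 ≡⟨ ℚP.*-identityʳ _ ⟩
  recip a * ι Y                      ∎
  where
  product : ι a * ι X ≡ ι b * ι Y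
  product = trans (sym (ι-* a X)) (trans (cong ι (sym bY≡aX)) (ι-* b Y))
  unit-left : ∀ e → e ≡ 1ℚ * e
  unit-left = solve-∀ ℚ-ring
  regroup : ∀ a ra x rb → (a * ra) * (x * rb) ≡ ra * (a * x) * rb
  regroup = solve-∀ ℚ-ring
  regroup′ : ∀ ra b y rb → ra * (b * y) * rb ≡ ra * y * (b * rb)
  regroup′ = solve-∀ ℚ-ring

Σ-cong : ∀ n {f g : ℕ → ℚ} → (∀ ν → ν < n → f (suc ν) ≡ g (suc ν)) → Σ₁ n f ≡ Σ₁ n g
Σ-cong zero    eq = refl
Σ-cong (suc n) eq =
  cong₂ _+_ (Σ-cong n (λ ν ν<n → eq ν (ℕP.m<n⇒m<1+n ν<n))) (eq n (ℕP.n<1+n n))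

Σ-zero : ∀ n → Σ₁ n (λ _ → 0ℚ) ≡ 0ℚ
Σ-zero zero    = refl
Σ-zero (suc n) = trans (cong (_+ 0ℚ) (Σ-zero n)) (ℚP.+-identityʳ 0ℚ)

Σ-+ : ∀ n f g → Σ₁ n (λ ν → f ν + g ν) ≡ Σ₁ n f + Σ₁ n g
Σ-+ zero    f g = refl
Σ-+ (suc n) f g = begin
  Σ₁ n (λ ν → f ν + g ν) + (f (suc n) + g (suc n))  ≡⟨ cong (_+ (f (suc n) + g (suc n))) (Σ-+ n f g) ⟩
  Σ₁ n f + Σ₁ n g + (f (suc n) + g (suc n))         ≡⟨ interchange (Σ₁ n f) (Σ₁ n g) (f (suc n)) (g (suc n)) ⟩
  Σ₁ n f + f (suc n) + (Σ₁ n g + g (suc n))         ∎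
  where
  interchange : ∀ a b c d → a + b + (c + d) ≡ a + c + (b + d)
  interchange = solve-∀ ℚ-ring

Σ-*ˡ : ∀ n c f → Σ₁ n (λ ν → c * f ν) ≡ c * Σ₁ n f
Σ-*ˡ zero    c f = sym (ℚP.*-zeroʳ c)
Σ-*ˡ (suc n) c f = trans (cong (_+ c * f (suc n)) (Σ-*ˡ n c f))
                         (sym (ℚP.*-distribˡ-+ c (Σ₁ n f) (f (suc n))))

Σ-*ʳ : ∀ n c f → Σ₁ n (λ ν → f ν * c) ≡ Σ₁ n f * c
Σ-*ʳ zero    c f = sym (ℚP.*-zeroˡ c)
Σ-*ʳ (suc n) c f = trans (cong (_+ f (suc n) * c) (Σ-*ʳ n c f))
                         (sym (ℚP.*-distribʳ-+ c (Σ₁ n f) (f (suc n))))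

Σ-neg : ∀ n f → Σ₁ n (λ ν → - f ν) ≡ - Σ₁ n f
Σ-neg zero    f = refl
Σ-neg (suc n) f = trans (cong (_+ - f (suc n)) (Σ-neg n f))
                        (sym (ℚP.neg-distrib-+ (Σ₁ n f) (f (suc n))))

Σ-swap : ∀ n m (g : ℕ → ℕ → ℚ) →
  Σ₁ n (λ ν → Σ₁ m (λ k → g ν k)) ≡ Σ₁ m (λ k → Σ₁ n (λ ν → g ν k))
Σ-swap zero    m g = sym (Σ-zero m)
Σ-swap (suc n) m g = begin
  Σ₁ n (λ ν → Σ₁ m (g ν)) + Σ₁ m (g (suc n))               ≡⟨ cong (_+ Σ₁ m (g (suc n))) (Σ-swap n m g) ⟩
  Σ₁ m (λ k → Σ₁ n (λ ν → g ν k)) + Σ₁ m (g (suc n))       ≡⟨ Σ-+ m (λ k → Σ₁ n (λ ν → g ν k)) (g (suc n)) ⟨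
  Σ₁ m (λ k → Σ₁ n (λ ν → g ν k) + g (suc n) k)            ∎

Σ-peel : ∀ m g → Σ₁ (suc m) g ≡ g 1 + Σ₁ m (λ ν → g (suc ν))
Σ-peel zero    g = trans (ℚP.+-identityˡ (g 1)) (sym (ℚP.+-identityʳ (g 1)))
Σ-peel (suc m) g = trans (cong (_+ g (suc (suc m))) (Σ-peel m g)) (ℚP.+-assoc (g 1) _ _)

Σ-vanishing-tail : ∀ {k N} f → k ≤ N → (∀ ν → k < ν → f ν ≡ 0ℚ) → Σ₁ N f ≡ Σ₁ k f
Σ-vanishing-tail {k} f k≤N vanish = go (ℕP.≤⇒≤′ k≤N)
  where
  go : ∀ {N} → k ℕ.≤′ N → Σ₁ N f ≡ Σ₁ k f
  go ℕ.≤′-refl            = refl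
  go (ℕ.≤′-step {N} k≤′N) = begin
    Σ₁ N f + f (suc N)  ≡⟨ cong₂ _+_ (go k≤′N) (vanish (suc N) (s≤s (ℕP.≤′⇒≤ k≤′N))) ⟩
    Σ₁ k f + 0ℚ         ≡⟨ ℚP.+-identityʳ (Σ₁ k f) ⟩
    Σ₁ k f              ∎

pascal : ∀ k ν → suc k C suc ν ≡ k C ν ℕ.+ k C suc ν
pascal k ν = sym (nCk+nC[k+1]≡[n+1]C[k+1] k ν)

C-absorption : ∀ k ν → suc ν ℕ.* (suc k C suc ν) ≡ suc k ℕ.* (k C ν)
C-absorption k       zero    =
  trans (ℕP.*-identityˡ _) (trans (nC1≡n (suc k)) (sym (ℕP.*-identityʳ (suc k))))
C-absorption zero    (suc ν) = ℕP.*-zeroʳ (suc (suc ν))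
C-absorption (suc k) (suc ν) = begin
  suc (suc ν) ℕ.* (suc (suc k) C suc (suc ν))
    ≡⟨ cong (suc (suc ν) ℕ.*_) (pascal (suc k) (suc ν)) ⟩
  suc (suc ν) ℕ.* (suc k C suc ν ℕ.+ suc k C suc (suc ν))
    ≡⟨ split (suc ν) (suc k C suc ν) (suc k C suc (suc ν)) ⟩
  suc ν ℕ.* (suc k C suc ν) ℕ.+ (suc k C suc ν ℕ.+ suc (suc ν) ℕ.* (suc k C suc (suc ν)))
    ≡⟨ cong₂ (λ a b → a ℕ.+ (suc k C suc ν ℕ.+ b)) (C-absorption k ν) (C-absorption k (suc ν)) ⟩
  suc k ℕ.* (k C ν) ℕ.+ (suc k C suc ν ℕ.+ suc k ℕ.* (k C suc ν))
    ≡⟨ cong (λ c → suc k ℕ.* (k C ν) ℕ.+ (c ℕ.+ suc k ℕ.* (k C suc ν))) (pascal k ν) ⟩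
  suc k ℕ.* (k C ν) ℕ.+ ((k C ν ℕ.+ k C suc ν) ℕ.+ suc k ℕ.* (k C suc ν))
    ≡⟨ merge (suc k) (k C ν) (k C suc ν) ⟩
  suc (suc k) ℕ.* (k C ν ℕ.+ k C suc ν)
    ≡⟨ cong (suc (suc k) ℕ.*_) (pascal k ν) ⟨
  suc (suc k) ℕ.* (suc k C suc ν) ∎
  where
  split : ∀ s a b → suc s ℕ.* (a ℕ.+ b) ≡ s ℕ.* a ℕ.+ (a ℕ.+ suc s ℕ.* b)
  split = ℕSolver.solve-∀
  merge : ∀ s a b → s ℕ.* a ℕ.+ ((a ℕ.+ b) ℕ.+ s ℕ.* b) ≡ suc s ℕ.* (a ℕ.+ b)
  merge = ℕSolver.solve-∀

-- The coefficient ν!·C(k,ν) of the ν-th derivative of X^k satisfies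
-- (k+1)·ν!·C(k,ν) = (ν+1)!·C(k+1,ν+1), the recursion of falling factorials.
falling-factorial-step : ∀ k ν → suc k ℕ.* (ν ! ℕ.* (k C ν)) ≡ suc ν ! ℕ.* (suc k C suc ν)
falling-factorial-step k ν = begin
  suc k ℕ.* (ν ! ℕ.* (k C ν))              ≡⟨ swap (suc k) (ν !) (k C ν) ⟩
  ν ! ℕ.* (suc k ℕ.* (k C ν))              ≡⟨ cong (ν ! ℕ.*_) (C-absorption k ν) ⟨
  ν ! ℕ.* (suc ν ℕ.* (suc k C suc ν))      ≡⟨ reassoc (ν !) (suc ν) (suc k C suc ν) ⟩
  suc ν ! ℕ.* (suc k C suc ν)              ∎
  where
  swap : ∀ a b c → a ℕ.* (b ℕ.* c) ≡ b ℕ.* (a ℕ.* c)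
  swap = ℕSolver.solve-∀
  reassoc : ∀ a b c → a ℕ.* (b ℕ.* c) ≡ (b ℕ.* a) ℕ.* c
  reassoc = ℕSolver.solve-∀

alternating-row-sum : ∀ m → Σ₁ (suc m) (λ ν → sign (suc ν) * ι (suc m C ν)) ≡ 1ℚ
alternating-row-sum m = begin
  Σ₁ (suc m) (λ ν → sign (suc ν) * ι (suc m C ν))
    ≡⟨ Σ-cong (suc m) (λ ν _ → unfold ν) ⟩
  Σ₁ (suc m) (λ ν → shifted ν + row ν)
    ≡⟨ Σ-+ (suc m) shifted row ⟩
  Σ₁ (suc m) shifted + (Σ₁ m row + row (suc m))
    ≡⟨ cong₂ (λ a b → a + (Σ₁ m row + b)) shifted-sum last-vanishes ⟩
  (1ℚ + - Σ₁ m row) + (Σ₁ m row + 0ℚ)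
    ≡⟨ cancel (Σ₁ m row) ⟩
  1ℚ ∎
  where
  row shifted : ℕ → ℚ
  row     ν = sign (suc ν) * ι (m C ν)
  shifted ν = sign (suc ν) * ι (m C ℕ.pred ν)
  unfold : ∀ ν → sign (suc (suc ν)) * ι (suc m C suc ν) ≡ shifted (suc ν) + row (suc ν)
  unfold ν = trans (cong (λ c → sign (suc (suc ν)) * ι c) (pascal m ν))
    (trans (cong (sign (suc (suc ν)) *_) (ι-+ (m C ν) (m C suc ν)))
           (ℚP.*-distribˡ-+ (sign (suc (suc ν))) (ι (m C ν)) (ι (m C suc ν))))
  shifted-sum : Σ₁ (suc m) shifted ≡ 1ℚ + - Σ₁ m row
  shifted-sum = trans (Σ-peel m shifted) (cong (1ℚ +_) (trans
    (Σ-cong m (λ ν _ → sym (ℚP.neg-distribˡ-* (sign (suc (suc ν))) (ι (m C suc ν))))) (Σ-neg m row)))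
  last-vanishes : row (suc m) ≡ 0ℚ
  last-vanishes = trans (cong (λ c → sign (suc (suc m)) * ι c) (k>n⇒nCk≡0 (ℕP.n<1+n m)))
                        (ℚP.*-zeroʳ (sign (suc (suc m))))
  cancel : ∀ a → (1ℚ + - a) + (a + 0ℚ) ≡ 1ℚ
  cancel = solve-∀ ℚ-ring

binomial-harmonic : ℕ → ℕ → ℚ
binomial-harmonic N k = Σ₁ N (λ ν → sign (suc ν) * ι (k C ν) * recip ν)

-- Its terms vanish for ν > k, so any upper limit N ≥ k gives the same value.
binomial-harmonic-extend : ∀ {k N} → k ≤ N → binomial-harmonic N k ≡ binomial-harmonic k k
binomial-harmonic-extend k≤N = Σ-vanishing-tail _ k≤N vanish
  where
  vanish : ∀ {k} ν → k < ν → sign (suc ν) * ι (k C ν) * recip ν ≡ 0ℚ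
  vanish ν k<ν = trans (cong (λ c → sign (suc ν) * ι c * recip ν) (k>n⇒nCk≡0 k<ν))
                       (annihilate (sign (suc ν)) (recip ν))
    where
    annihilate : ∀ s r → s * 0ℚ * r ≡ 0ℚ
    annihilate = solve-∀ ℚ-ring

-- Fact (1): H_k = Σ_{ν=1}^{k} (-1)^{ν+1} C(k,ν)/ν.  Pascal's rule splits the
-- sum for k+1 into the sum for k and, by absorption, 1/(k+1) times an
-- alternating row sum.
harmonic-as-binomial-sum : ∀ k → binomial-harmonic k k ≡ H k
harmonic-as-binomial-sum zero    = refl
harmonic-as-binomial-sum (suc k) = begin
  binomial-harmonic (suc k) (suc k)
    ≡⟨ Σ-cong (suc k) (λ ν _ → unfold ν) ⟩
  Σ₁ (suc k) (λ ν → term ν + shifted ν)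
    ≡⟨ Σ-+ (suc k) term shifted ⟩
  binomial-harmonic (suc k) k + Σ₁ (suc k) shifted
    ≡⟨ cong₂ _+_ previous (Σ-cong (suc k) (λ ν _ → absorb ν)) ⟩
  H k + Σ₁ (suc k) (λ ν → recip (suc k) * (sign (suc ν) * ι (suc k C ν)))
    ≡⟨ cong (H k +_) (Σ-*ˡ (suc k) (recip (suc k)) (λ ν → sign (suc ν) * ι (suc k C ν))) ⟩
  H k + recip (suc k) * Σ₁ (suc k) (λ ν → sign (suc ν) * ι (suc k C ν))
    ≡⟨ cong (λ z → H k + recip (suc k) * z) (alternating-row-sum k) ⟩
  H k + recip (suc k) * 1ℚ
    ≡⟨ cong (H k +_) (ℚP.*-identityʳ (recip (suc k))) ⟩
  H k + recip (suc k) ∎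
  where
  term shifted : ℕ → ℚ
  term    ν = sign (suc ν) * ι (k C ν) * recip ν
  shifted ν = sign (suc ν) * ι (k C ℕ.pred ν) * recip ν
  unfold : ∀ ν → sign (suc (suc ν)) * ι (suc k C suc ν) * recip (suc ν) ≡ term (suc ν) + shifted (suc ν)
  unfold ν = trans (cong (λ c → sign (suc (suc ν)) * ι c * recip (suc ν)) (pascal k ν))
    (trans (cong (λ z → sign (suc (suc ν)) * z * recip (suc ν)) (ι-+ (k C ν) (k C suc ν)))
           (distribute (sign (suc (suc ν))) (ι (k C ν)) (ι (k C suc ν)) (recip (suc ν))))
    where
    distribute : ∀ s a b r → s * (a + b) * r ≡ s * b * r + s * a * r
    distribute = solve-∀ ℚ-ring
  previous : binomial-harmonic (suc k) k ≡ H k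
  previous = trans (binomial-harmonic-extend (ℕP.n≤1+n k)) (harmonic-as-binomial-sum k)
  absorb : ∀ ν → shifted (suc ν) ≡ recip (suc k) * (sign (suc (suc ν)) * ι (suc k C suc ν))
  absorb ν = begin
    s * ι (k C ν) * recip (suc ν)           ≡⟨ ℚP.*-assoc s (ι (k C ν)) (recip (suc ν)) ⟩
    s * (ι (k C ν) * recip (suc ν))         ≡⟨ cong (s *_) (cross-ratio (suc k) (suc ν) (k C ν) (suc k C suc ν) (C-absorption k ν)) ⟩
    s * (recip (suc k) * ι (suc k C suc ν)) ≡⟨ commute s (recip (suc k)) (ι (suc k C suc ν)) ⟩
    recip (suc k) * (s * ι (suc k C suc ν)) ∎
    where
    s : ℚ
    s = sign (suc (suc ν))
    commute : ∀ a b c → a * (b * c) ≡ b * (a * c)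
    commute = solve-∀ ℚ-ring

eval-⊕ : ∀ p q x → eval (p ⊕ q) x ≡ eval p x + eval q x
eval-⊕ []      q       x = sym (ℚP.+-identityˡ (eval q x))
eval-⊕ (a ∷ p) []      x = sym (ℚP.+-identityʳ (eval (a ∷ p) x))
eval-⊕ (a ∷ p) (b ∷ q) x = begin
  (a + b) + x * eval (p ⊕ q) x               ≡⟨ cong (λ z → (a + b) + x * z) (eval-⊕ p q x) ⟩
  (a + b) + x * (eval p x + eval q x)        ≡⟨ rearrange a b (eval p x) (eval q x) x ⟩
  (a + x * eval p x) + (b + x * eval q x)    ∎
  where
  rearrange : ∀ a b P Q x → (a + b) + x * (P + Q) ≡ (a + x * P) + (b + x * Q)
  rearrange = solve-∀ ℚ-ring

eval-ΣP : ∀ n f x → eval (ΣP₁ n f) x ≡ Σ₁ n (λ ν → eval (f ν) x)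
eval-ΣP zero    f x = refl
eval-ΣP (suc n) f x = trans (eval-⊕ (ΣP₁ n f) (f (suc n)) x) (cong (_+ eval (f (suc n)) x) (eval-ΣP n f x))

eval-monomial : ∀ c k x → eval (monomial c k) x ≡ c * pow x k
eval-monomial c zero    x = trans (cong (c +_) (ℚP.*-zeroʳ x)) (trans (ℚP.+-identityʳ c) (sym (ℚP.*-identityʳ c)))
eval-monomial c (suc k) x = begin
  0ℚ + x * eval (monomial c k) x  ≡⟨ cong (λ z → 0ℚ + x * z) (eval-monomial c k x) ⟩
  0ℚ + x * (c * pow x k)          ≡⟨ shift c x (pow x k) ⟩
  c * (x * pow x k)               ∎
  where
  shift : ∀ c x P → 0ℚ + x * (c * P) ≡ c * (x * P)
  shift = solve-∀ ℚ-ring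

eval-coefficients : ∀ n (c : ℕ → ℚ) x → eval (ΣP₁ n (λ k → monomial (c k) k)) x ≡ Σ₁ n (λ k → c k * pow x k)
eval-coefficients n c x = trans (eval-ΣP n (λ k → monomial (c k) k) x)
                                (Σ-cong n (λ k _ → eval-monomial (c (suc k)) (suc k) x))

derivAux-⊕ : ∀ k p q → derivAux k (p ⊕ q) ≡ derivAux k p ⊕ derivAux k q
derivAux-⊕ k []      q       = refl
derivAux-⊕ k (a ∷ p) []      = refl
derivAux-⊕ k (a ∷ p) (b ∷ q) = cong₂ _∷_ (ℚP.*-distribˡ-+ (ι k) a b) (derivAux-⊕ (suc k) p q)

deriv-⊕ : ∀ p q → deriv (p ⊕ q) ≡ deriv p ⊕ deriv q
deriv-⊕ []      q       = refl
deriv-⊕ (a ∷ p) []      = sym (right-unit (deriv (a ∷ p)))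
  where
  right-unit : ∀ p → p ⊕ [] ≡ p
  right-unit []      = refl
  right-unit (a ∷ p) = refl
deriv-⊕ (a ∷ p) (b ∷ q) = derivAux-⊕ 1 p q

deriv^-⊕ : ∀ ν p q → deriv^ ν (p ⊕ q) ≡ deriv^ ν p ⊕ deriv^ ν q
deriv^-⊕ zero    p q = refl
deriv^-⊕ (suc ν) p q = trans (cong deriv (deriv^-⊕ ν p q)) (deriv-⊕ (deriv^ ν p) (deriv^ ν q))

deriv^-[] : ∀ ν → deriv^ ν [] ≡ []
deriv^-[] zero    = refl
deriv^-[] (suc ν) = cong deriv (deriv^-[] ν)

deriv^-ΣP : ∀ ν n f → deriv^ ν (ΣP₁ n f) ≡ ΣP₁ n (λ k → deriv^ ν (f k))
deriv^-ΣP ν zero    f = deriv^-[] ν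
deriv^-ΣP ν (suc n) f = trans (deriv^-⊕ ν (ΣP₁ n f) (f (suc n))) (cong (_⊕ deriv^ ν (f (suc n))) (deriv^-ΣP ν n f))

deriv^-suc : ∀ ν p → deriv^ (suc ν) p ≡ deriv^ ν (deriv p)
deriv^-suc zero    p = refl
deriv^-suc (suc ν) p = cong deriv (deriv^-suc ν p)

derivAux-monomial : ∀ j k c →
  derivAux j (replicate k 0ℚ ++ (c ∷ [])) ≡ replicate k 0ℚ ++ ((ι (j ℕ.+ k) * c) ∷ [])
derivAux-monomial j zero    c = cong (λ i → (ι i * c) ∷ []) (sym (ℕP.+-identityʳ j))
derivAux-monomial j (suc k) c = cong₂ _∷_ (ℚP.*-zeroʳ (ι j))
  (trans (derivAux-monomial (suc j) k c)
         (cong (λ i → replicate k 0ℚ ++ ((ι i * c) ∷ [])) (sym (ℕP.+-suc j k))))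

deriv-monomial : ∀ c k → deriv (monomial c (suc k)) ≡ monomial (ι (suc k) * c) k
deriv-monomial c k = derivAux-monomial 1 k c

monomial-derivative : ∀ ν k c x →
  eval (deriv^ ν (monomial c k)) x * pow x ν ≡ c * ι (ν ! ℕ.* (k C ν)) * pow x k
monomial-derivative zero    k       c x =
  trans (ℚP.*-identityʳ _) (trans (eval-monomial c k x) (cong (_* pow x k) (sym (ℚP.*-identityʳ c))))
monomial-derivative (suc ν) zero    c x = begin
  eval (deriv^ (suc ν) (monomial c 0)) x * pow x (suc ν)
    ≡⟨ cong (λ p → eval p x * pow x (suc ν)) (trans (deriv^-suc ν (monomial c 0)) (deriv^-[] ν)) ⟩
  0ℚ * pow x (suc ν)
    ≡⟨ annihilate c (pow x (suc ν)) ⟩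
  c * ι 0 * 1ℚ
    ≡⟨ cong (λ n → c * ι n * 1ℚ) (ℕP.*-zeroʳ (suc ν !)) ⟨
  c * ι (suc ν ! ℕ.* 0) * 1ℚ ∎
  where
  annihilate : ∀ c y → 0ℚ * y ≡ c * 0ℚ * 1ℚ
  annihilate = solve-∀ ℚ-ring
monomial-derivative (suc ν) (suc k) c x = begin
  eval (deriv^ (suc ν) (monomial c (suc k))) x * pow x (suc ν)
    ≡⟨ cong (λ p → eval p x * pow x (suc ν)) (trans (deriv^-suc ν _) (cong (deriv^ ν) (deriv-monomial c k))) ⟩
  E * (x * pow x ν)
    ≡⟨ pull-x E x (pow x ν) ⟩
  x * (E * pow x ν)
    ≡⟨ cong (x *_) (monomial-derivative ν k (ι (suc k) * c) x) ⟩
  x * (ι (suc k) * c * ι (ν ! ℕ.* (k C ν)) * pow x k)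
    ≡⟨ regroup x (ι (suc k)) c (ι (ν ! ℕ.* (k C ν))) (pow x k) ⟩
  c * (ι (suc k) * ι (ν ! ℕ.* (k C ν))) * (x * pow x k)
    ≡⟨ cong (λ z → c * z * (x * pow x k)) (trans (sym (ι-* (suc k) (ν ! ℕ.* (k C ν)))) (cong ι (falling-factorial-step k ν))) ⟩
  c * ι (suc ν ! ℕ.* (suc k C suc ν)) * pow x (suc k) ∎
  where
  E : ℚ
  E = eval (deriv^ ν (monomial (ι (suc k) * c) k)) x
  pull-x : ∀ e x p → e * (x * p) ≡ x * (e * p)
  pull-x = solve-∀ ℚ-ring
  regroup : ∀ x i c f p → x * (i * c * f * p) ≡ c * (i * f) * (x * p)
  regroup = solve-∀ ℚ-ring

taylor-coefficients : ∀ ν n (c : ℕ → ℚ) x →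
  eval (deriv^ ν (ΣP₁ n (λ k → monomial (c k) k))) x * recip (ν !) * pow x ν
    ≡ Σ₁ n (λ k → c k * ι (k C ν) * pow x k)
taylor-coefficients ν n c x = begin
  eval (deriv^ ν (ΣP₁ n (λ k → monomial (c k) k))) x * recip (ν !) * pow x ν
    ≡⟨ cong (λ p → eval p x * recip (ν !) * pow x ν) (deriv^-ΣP ν n (λ k → monomial (c k) k)) ⟩
  eval (ΣP₁ n D) x * recip (ν !) * pow x ν
    ≡⟨ cong (λ z → z * recip (ν !) * pow x ν) (eval-ΣP n D x) ⟩
  Σ₁ n (λ k → eval (D k) x) * recip (ν !) * pow x ν
    ≡⟨ trans (Σ-*ʳ n (pow x ν) _) (cong (_* pow x ν) (Σ-*ʳ n (recip (ν !)) _)) ⟨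
  Σ₁ n (λ k → eval (D k) x * recip (ν !) * pow x ν)
    ≡⟨ Σ-cong n (λ k _ → monomial-term (suc k)) ⟩
  Σ₁ n (λ k → c k * ι (k C ν) * pow x k) ∎
  where
  D : ℕ → Poly
  D k = deriv^ ν (monomial (c k) k)
  monomial-term : ∀ k → eval (D k) x * recip (ν !) * pow x ν ≡ c k * ι (k C ν) * pow x k
  monomial-term k = begin
    eval (D k) x * recip (ν !) * pow x ν
      ≡⟨ pull (eval (D k) x) (recip (ν !)) (pow x ν) ⟩
    recip (ν !) * (eval (D k) x * pow x ν)
      ≡⟨ cong (recip (ν !) *_) (monomial-derivative ν k (c k) x) ⟩
    recip (ν !) * (c k * ι (ν ! ℕ.* (k C ν)) * pow x k)
      ≡⟨ cong (λ z → recip (ν !) * (c k * z * pow x k)) (ι-* (ν !) (k C ν)) ⟩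
    recip (ν !) * (c k * (ι (ν !) * ι (k C ν)) * pow x k)
      ≡⟨ regroup (recip (ν !)) (c k) (ι (ν !)) (ι (k C ν)) (pow x k) ⟩
    (ι (ν !) * recip (ν !)) * (c k * ι (k C ν) * pow x k)
      ≡⟨ cong (_* (c k * ι (k C ν) * pow x k)) (ι-recip (ν !) {{ν ℕP.!≢0}}) ⟩
    1ℚ * (c k * ι (k C ν) * pow x k)
      ≡⟨ ℚP.*-identityˡ _ ⟩
    c k * ι (k C ν) * pow x k ∎
    where
    pull : ∀ e r p → e * r * p ≡ r * (e * p)
    pull = solve-∀ ℚ-ring
    regroup : ∀ r c i b p → r * (c * (i * b) * p) ≡ (i * r) * (c * b * p)
    regroup = solve-∀ ℚ-ring

-- The theorem: expand H_k by fact (1), swap the two sums, and recognise the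
-- inner sums by fact (2) applied to Fₙ = Σ_k a_k X^k.  The argument does not
-- need the hypothesis n ≥ 1.
proposition4p1 : (n : ℕ) → 1 ≤ n → (x : ℚ) →
    eval (Fhat n) x ≡
      Σ₁ n (λ ν → sign (suc ν) * (eval (deriv^ ν (F n)) x * recip (ν !)) * (pow x ν * recip ν))
proposition4p1 n _ x = begin
  eval (Fhat n) x                           ≡⟨ eval-coefficients n (λ k → a k * H k) x ⟩
  Σ₁ n (λ k → a k * H k * pow x k)          ≡⟨ Σ-cong n (λ k k<n → expand-harmonic (suc k) k<n) ⟩
  Σ₁ n (λ k → Σ₁ n (λ ν → term ν k))        ≡⟨ Σ-swap n n (λ k ν → term ν k) ⟩
  Σ₁ n (λ ν → Σ₁ n (λ k → term ν k))        ≡⟨ Σ-cong n (λ ν _ → collect (suc ν)) ⟩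
  Σ₁ n (λ ν → sign (suc ν) * (eval (deriv^ ν (F n)) x * recip (ν !)) * (pow x ν * recip ν)) ∎
  where
  a : ℕ → ℚ
  a k = ι (k ! ℕ.* S₂ n k)
  term : ℕ → ℕ → ℚ
  term ν k = a k * pow x k * (sign (suc ν) * ι (k C ν) * recip ν)
  expand-harmonic : ∀ k → k ≤ n → a k * H k * pow x k ≡ Σ₁ n (λ ν → term ν k)
  expand-harmonic k k≤n = begin
    a k * H k * pow x k
      ≡⟨ swap-last (a k) (H k) (pow x k) ⟩
    a k * pow x k * H k
      ≡⟨ cong (a k * pow x k *_) (trans (binomial-harmonic-extend k≤n) (harmonic-as-binomial-sum k)) ⟨
    a k * pow x k * binomial-harmonic n k
      ≡⟨ Σ-*ˡ n (a k * pow x k) _ ⟨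
    Σ₁ n (λ ν → term ν k) ∎
    where
    swap-last : ∀ a h p → a * h * p ≡ a * p * h
    swap-last = solve-∀ ℚ-ring
  collect : ∀ ν → Σ₁ n (λ k → term ν k)
    ≡ sign (suc ν) * (eval (deriv^ ν (F n)) x * recip (ν !)) * (pow x ν * recip ν)
  collect ν = begin
    Σ₁ n (λ k → term ν k)
      ≡⟨ Σ-cong n (λ k _ → factor (a (suc k)) (pow x (suc k)) s (ι (suc k C ν)) (recip ν)) ⟩
    Σ₁ n (λ k → s * recip ν * (a k * ι (k C ν) * pow x k))
      ≡⟨ Σ-*ˡ n (s * recip ν) _ ⟩
    s * recip ν * Σ₁ n (λ k → a k * ι (k C ν) * pow x k)
      ≡⟨ cong (s * recip ν *_) (taylor-coefficients ν n a x) ⟨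
    s * recip ν * (Dₙ * recip (ν !) * pow x ν)
      ≡⟨ rearrange s (recip ν) Dₙ (recip (ν !)) (pow x ν) ⟩
    s * (Dₙ * recip (ν !)) * (pow x ν * recip ν) ∎
    where
    Dₙ : ℚ
    Dₙ = eval (deriv^ ν (F n)) x
    s : ℚ
    s = sign (suc ν)
    factor : ∀ a p s b r → a * p * (s * b * r) ≡ s * r * (a * b * p)
    factor = solve-∀ ℚ-ring
    rearrange : ∀ s r e f p → s * r * (e * f * p) ≡ s * (e * f) * (p * r)
    rearrange = solve-∀ ℚ-ring
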